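{- Let $k\ge 1$ be an integer and let $L=(X,U)$ be a finite undirected graph without loops that has a proper vertex coloring using at most $k$ colors. Then for every integer $l\ge 2$ with $\gcd(l,k)=1$ there exists an equivalence class $C$ of orientations of $L$ modulo $k$ whose two adjacent subclasses have cardinalities that are not congruent modulo $l$.
   Context: An orientation of $L$ is a directed graph obtained from $L$ by choosing a direction for each edge. For an orientation $\vec L$ and a vertex $x$, let $s^+_{\vec L}(x)$ be the number of edges directed out of $x$ in $\vec L$. Two orientations $\vec L',\vec L''$ are congruent modulo $k$ if $s^+_{\vec L'}(x)\equiv s^+_{\vec L''}(x)\pmod k$ for every vertex $x$; the classes of this equivalence relation are the equivalence classes modulo $k$. Two orientations agree if one is obtained from the other by reversing an even number of edges; this is an equivalence relation with two classes on the set of all orientations. Each equivalence class $C$ modulo $k$ is split by the agreement relation into two subclasses (the intersections of $C$ with the two agreement classes; one may be empty), called the two adjacent subclasses of $C$. -}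

module Defs where

open import Data.Nat using (ℕ; zero; suc; _≤_; ∣_-_∣)
open import Data.Nat.Divisibility using (_∣_; _∣?_)
open import Data.Nat.GCD using (gcd)
open import Data.Fin using (Fin; _≟_)
open import Data.Bool using (Bool; true; false; if_then_else_)
open import Data.Product using (_×_; proj₁; proj₂; Σ; ∃)
open import Data.List using (List; []; _∷_; _++_; map; filter; length; allFin)
open import Data.Vec.Functional using (Vector) renaming (_∷_ to _∷ᶠ_)
open import Relation.Nullary using (¬_; Dec; yes; no)
open import Relation.Nullary.Decidable using (¬?; _×-dec_)
open import Relation.Binary.PropositionalEquality using (_≡_; _≢_)

-- A finite loopless (multi)graph L = (X, U): vertex set X = Fin n,
-- edge set U = Fin m, each edge e given by its two (distinct) endpoints.
record Graph : Set where
  field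
    n     : ℕ
    m     : ℕ
    ends  : Fin m → Fin n × Fin n
    loopless : ∀ e → proj₁ (ends e) ≢ proj₂ (ends e)
open Graph public

ProperColoring : Graph → ℕ → Set
ProperColoring L k =
  Σ (Fin (n L) → Fin k) λ c → ∀ e → c (proj₁ (ends L e)) ≢ c (proj₂ (ends L e))

-- An orientation: for each edge e = {u,v} (ends e = (u , v)) we choose
-- true  : e directed u → v,  false : e directed v → u.
Orientation : Graph → Set
Orientation L = Fin (m L) → Bool

allBoolFuns : (m : ℕ) → List (Fin m → Bool)
allBoolFuns zero = (λ ()) ∷ []
allBoolFuns (suc m) =
  map (true ∷ᶠ_) (allBoolFuns m) ++ map (false ∷ᶠ_) (allBoolFuns m)

allOrientations : (L : Graph) → List (Orientation L)
allOrientations L = allBoolFuns (m L)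

tailOf : (L : Graph) → Orientation L → Fin (m L) → Fin (n L)
tailOf L o e = if o e then proj₁ (ends L e) else proj₂ (ends L e)

outdeg : (L : Graph) → Orientation L → Fin (n L) → ℕ
outdeg L o x = length (filter (λ e → tailOf L o e ≟ x) (allFin (m L)))

_≡_[mod_] : ℕ → ℕ → ℕ → Set
a ≡ b [mod k ] = k ∣ ∣ a - b ∣

congMod? : ∀ a b k → Dec (a ≡ b [mod k ])
congMod? a b k = k ∣? ∣ a - b ∣

bdiff : Bool → Bool → Bool
bdiff true true = false
bdiff false false = false
bdiff _ _ = true

numDiffer : (L : Graph) → Orientation L → Orientation L → ℕ
numDiffer L o o' = length (filter (λ e → bdiff (o e) (o' e) Data.Bool.≟ true) (allFin (m L)))
  where import Data.Bool

Congruent : (L : Graph) → ℕ → Orientation L → Orientation L → Set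
Congruent L k o o' = ∀ x → outdeg L o x ≡ outdeg L o' x [mod k ]

congruent? : (L : Graph) (k : ℕ) (o o' : Orientation L) → Dec (Congruent L k o o')
congruent? L k o o' = Data.Fin.Properties.all? (λ x → congMod? (outdeg L o x) (outdeg L o' x) k)
  where import Data.Fin.Properties

Agree : (L : Graph) → Orientation L → Orientation L → Set
Agree L o o' = 2 ∣ numDiffer L o o'

agree? : (L : Graph) (o o' : Orientation L) → Dec (Agree L o o')
agree? L o o' = 2 ∣? numDiffer L o o'

-- The equivalence class modulo k of o₀ is {o | Congruent L k o o₀}.
-- Its two adjacent subclasses: the members agreeing with o₀, and those not.
subclassAgree : (L : Graph) → ℕ → Orientation L → ℕ
subclassAgree L k o₀ =
  length (filter (λ o → congruent? L k o o₀ ×-dec agree? L o o₀) (allOrientations L))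

subclassDisagree : (L : Graph) → ℕ → Orientation L → ℕ
subclassDisagree L k o₀ =
  length (filter (λ o → congruent? L k o o₀ ×-dec ¬? (agree? L o o₀)) (allOrientations L))

module Submission where

-- Fix a proper colouring c with colours < k, and for an edge e let
-- a e, b e be the colours of its two ends.  An orientation o has sign σ(o) = ±1
-- (one −1 per reversed edge) and weight φ(o) = Σₑ c(tail e) = Σᵥ c(v)·s⁺(v), so
-- congruent orientations have weights congruent modulo k.  Expanding the product
--   H = ∏ₑ (Tᵃ⁽ᵉ⁾ − Tᵇ⁽ᵉ⁾) δ,   δ = indicator of kℕ,   (Tˢ w)(x) = w(x + s)
-- gives H(x) = Σₒ σ(o)·δ(x + φ(o)), a signed sum over a union of congruence
-- classes.  If every class had subclasses of congruent sizes mod l, the signed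
-- size σ(o₀)(|C⁺| − |C⁻|) of every class, hence H, would vanish modulo l.
-- On the other hand, with K = ∏_{q ∣ k prime} Δ_{k/q} (Δ_d w = w − T^d w) one has
-- (Kδ)(0) = 1, and since a e ≢ b e (mod k) and gcd(l, k) = 1 each factor of H can
-- be peeled off without losing non-vanishing of K modulo l; so K H ≢ 0 (mod l).

open import Defs
open import Data.Nat using (ℕ; _≤_)
open import Data.Nat.GCD using (gcd)
open import Data.Product using (∃)
open import Relation.Nullary using (¬_)
open import Relation.Binary.PropositionalEquality using (_≡_)

open import Data.Nat as ℕ using (zero; suc; _<_; _∸_; s≤s; NonZero)
import Data.Nat.Properties as ℕP
import Data.Nat.Tactic.RingSolver as ℕSolver
open import Data.Nat.Divisibility as ℕD using (divides; _∣?_)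
open import Data.Nat.DivMod using (_/_; m/n*n≡m)
open import Data.Nat.GCD using (gcd[m,n]∣m; gcd[m,n]∣n; gcd-GCD; module Bézout)
open import Data.Nat.Coprimality using (Coprime; coprime-divisor; gcd≡1⇒coprime)
open import Data.Nat.Primality using (Prime; prime?; ¬prime[0]; prime⇒nonZero)
open import Data.Nat.Primality.Factorisation using (factorise; factorisationHasAllPrimeFactors)
open import Data.Nat.ListAction using (product)
open import Data.Integer as ℤ using (ℤ; +_; _+_; _-_; _*_; -_; -1ℤ; _^_)
import Data.Integer.Properties as ℤP
import Data.Integer.Divisibility.Signed as ℤD
open import Data.Integer.Tactic.RingSolver using (solve-∀)
open import Data.List using (List; []; _∷_; _++_; map; filter; length; upTo; tabulate)
open import Data.List.Membership.Propositional using (_∈_)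
open import Data.List.Membership.Propositional.Properties using (∈-map⁺; ∈-filter⁺; ∈-filter⁻; ∈-upTo⁺)
open import Data.List.Relation.Unary.Any using (here; there; any?; satisfied)
open import Data.List.Relation.Unary.All as All using (All; []; _∷_)
open import Data.List.Relation.Unary.All.Properties using (All¬⇒¬Any; ¬Any⇒All¬; all-filter)
open import Data.List.Relation.Unary.Unique.Propositional using (Unique; []; _∷_)
import Data.List.Relation.Unary.Unique.Propositional.Properties as Unique
open import Data.Product using (Σ; _,_; _×_; proj₁; proj₂)
open import Data.Sum using (_⊎_; inj₁; inj₂)
open import Data.Empty using (⊥-elim)
open import Relation.Nullary using (Dec; yes; no; does; contradiction)
open import Data.Bool as Bool using (Bool; true; false; if_then_else_)
open import Relation.Nullary.Decidable using (_×-dec_; ¬?; decidable-stable)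
open import Relation.Binary.Definitions using (tri<; tri≈; tri>)
open import Data.Vec.Functional using () renaming (_∷_ to _∷ᶠ_)
open import Algebra.Properties.Semiring.Sum ℕP.+-*-semiring using (sum; sum-cong-≗; sum-replicate-zero; ∑-comm; *-distribˡ-sum)
open import Data.Fin.Properties using (toℕ<n; toℕ-injective)
open import Data.Fin as Fin using (Fin; toℕ) renaming (zero to fzero; suc to fsuc)
open import Relation.Binary.PropositionalEquality
  using (refl; sym; trans; cong; cong₂; subst; _≗_; _≢_; module ≡-Reasoning)

infix 4 _∣ᶻ_

_∣ᶻ_ : ℕ → ℤ → Set
q ∣ᶻ z = + q ℤD.∣ z

∣ᶻ-0 : ∀ {q} → q ∣ᶻ + 0
∣ᶻ-0 = ℤD.divides (+ 0) refl

shift-swap : ∀ x a b → x ℕ.+ a ℕ.+ b ≡ x ℕ.+ b ℕ.+ a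
shift-swap = ℕSolver.solve-∀

diff-exchange : ∀ (p q r s : ℤ) → (p - q) - (r - s) ≡ (p - r) - (q - s)
diff-exchange = solve-∀

diff-chain : ∀ (p q r : ℤ) → (p - q) + (q - r) ≡ p - r
diff-chain = solve-∀

diff-negate : ∀ (p q : ℤ) → - (p - q) ≡ q - p
diff-negate = solve-∀

𝟙 : ∀ {A : Set} → Dec A → ℤ
𝟙 A? = if does A? then + 1 else + 0

∑ᴸ : ∀ {A : Set} → List A → (A → ℤ) → ℤ
∑ᴸ [] F = + 0
∑ᴸ (a ∷ as) F = F a + ∑ᴸ as F

module _ {A : Set} where

  ∑ᴸ-cong : ∀ (xs : List A) {F G : A → ℤ} → (∀ a → F a ≡ G a) → ∑ᴸ xs F ≡ ∑ᴸ xs G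
  ∑ᴸ-cong [] eq = refl
  ∑ᴸ-cong (a ∷ as) eq = cong₂ _+_ (eq a) (∑ᴸ-cong as eq)

  ∑ᴸ-++ : ∀ (xs ys : List A) F → ∑ᴸ (xs ++ ys) F ≡ ∑ᴸ xs F + ∑ᴸ ys F
  ∑ᴸ-++ [] ys F = sym (ℤP.+-identityˡ _)
  ∑ᴸ-++ (a ∷ as) ys F = trans (cong (λ t → F a + t) (∑ᴸ-++ as ys F)) (sym (ℤP.+-assoc (F a) _ _))

  ∑ᴸ-map : ∀ {B : Set} (g : B → A) (xs : List B) F → ∑ᴸ (map g xs) F ≡ ∑ᴸ xs (λ b → F (g b))
  ∑ᴸ-map g [] F = refl
  ∑ᴸ-map g (b ∷ bs) F = cong (λ t → F (g b) + t) (∑ᴸ-map g bs F)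

  ∑ᴸ-+ : ∀ (xs : List A) F G → ∑ᴸ xs (λ a → F a + G a) ≡ ∑ᴸ xs F + ∑ᴸ xs G
  ∑ᴸ-+ [] F G = refl
  ∑ᴸ-+ (a ∷ as) F G = trans (cong (λ t → F a + G a + t) (∑ᴸ-+ as F G)) (interchange (F a) (G a) _ _)
    where
      interchange : ∀ (p q r s : ℤ) → (p + q) + (r + s) ≡ (p + r) + (q + s)
      interchange = solve-∀

  ∑ᴸ-neg : ∀ (xs : List A) F → ∑ᴸ xs (λ a → - F a) ≡ - ∑ᴸ xs F
  ∑ᴸ-neg [] F = refl
  ∑ᴸ-neg (a ∷ as) F = trans (cong (λ t → - F a + t) (∑ᴸ-neg as F)) (sym (ℤP.neg-distrib-+ (F a) _))

  ∑ᴸ-− : ∀ (xs : List A) F G → ∑ᴸ xs (λ a → F a - G a) ≡ ∑ᴸ xs F - ∑ᴸ xs G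
  ∑ᴸ-− xs F G = trans (∑ᴸ-+ xs F (λ a → - G a)) (cong (λ t → ∑ᴸ xs F + t) (∑ᴸ-neg xs G))

  ∑ᴸ-scale : ∀ (xs : List A) c F → ∑ᴸ xs (λ a → c * F a) ≡ c * ∑ᴸ xs F
  ∑ᴸ-scale [] c F = sym (ℤP.*-zeroʳ c)
  ∑ᴸ-scale (a ∷ as) c F =
    trans (cong (λ t → c * F a + t) (∑ᴸ-scale as c F)) (sym (ℤP.*-distribˡ-+ c (F a) _))

  ∑ᴸ-vanish : ∀ (xs : List A) F → (∀ {a} → a ∈ xs → F a ≡ + 0) → ∑ᴸ xs F ≡ + 0
  ∑ᴸ-vanish [] F vanishes = refl
  ∑ᴸ-vanish (a ∷ as) F vanishes = cong₂ _+_ (vanishes (here refl)) (∑ᴸ-vanish as F (λ a∈as → vanishes (there a∈as)))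

  length-filter : ∀ {P : A → Set} (P? : ∀ a → Dec (P a)) xs →
                  + length (filter P? xs) ≡ ∑ᴸ xs (λ a → 𝟙 (P? a))
  length-filter P? [] = refl
  length-filter P? (a ∷ as) with does (P? a)
  ... | true  = cong (λ t → + 1 + t) (length-filter P? as)
  ... | false = trans (length-filter P? as) (sym (ℤP.+-identityˡ _))

-- H m a b w = ∏ₑ (Tᵃ⁽ᵉ⁾ − Tᵇ⁽ᵉ⁾) w  for e < m, where (Tˢ w) x = w (x + s)
H : ∀ m → (Fin m → ℕ) → (Fin m → ℕ) → (ℕ → ℤ) → (ℕ → ℤ)
H zero a b w = w
H (suc m) a b w x = H m (λ e → a (fsuc e)) (λ e → b (fsuc e)) w (x ℕ.+ a fzero)
                  - H m (λ e → a (fsuc e)) (λ e → b (fsuc e)) w (x ℕ.+ b fzero)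

sgn : Bool → ℤ
sgn true  = + 1
sgn false = -1ℤ

sign : ∀ {m} → (Fin m → Bool) → ℤ
sign {zero} o = + 1
sign {suc m} o = sgn (o fzero) * sign (λ e → o (fsuc e))

weight : ∀ {m} → (Fin m → ℕ) → (Fin m → ℕ) → (Fin m → Bool) → ℕ
weight a b o = sum (λ e → if o e then a e else b e)

H-expansion : ∀ m a b w x →
              H m a b w x ≡ ∑ᴸ (allBoolFuns m) (λ o → sign o * w (x ℕ.+ weight a b o))
H-expansion zero a b w x =
  sym (trans (ℤP.+-identityʳ _) (trans (ℤP.*-identityˡ _) (cong w (ℕP.+-identityʳ x))))
H-expansion (suc m) a b w x = sym (begin
    ∑ᴸ (map (true ∷ᶠ_) X ++ map (false ∷ᶠ_) X) F
      ≡⟨ ∑ᴸ-++ (map (true ∷ᶠ_) X) _ F ⟩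
    ∑ᴸ (map (true ∷ᶠ_) X) F + ∑ᴸ (map (false ∷ᶠ_) X) F
      ≡⟨ cong₂ _+_ (∑ᴸ-map (true ∷ᶠ_) X F) (∑ᴸ-map (false ∷ᶠ_) X F) ⟩
    ∑ᴸ X (λ o → F (true ∷ᶠ o)) + ∑ᴸ X (λ o → F (false ∷ᶠ o))
      ≡⟨ cong₂ _+_ (∑ᴸ-cong X (choose-a)) (trans (∑ᴸ-cong X choose-b) (∑ᴸ-neg X _)) ⟩
    ∑ᴸ X (λ o → sign o * w (x ℕ.+ a fzero ℕ.+ weight a′ b′ o))
      - ∑ᴸ X (λ o → sign o * w (x ℕ.+ b fzero ℕ.+ weight a′ b′ o))
      ≡⟨ cong₂ _-_ (sym (H-expansion m a′ b′ w _)) (sym (H-expansion m a′ b′ w _)) ⟩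
    H (suc m) a b w x ∎)
  where
    open ≡-Reasoning
    X = allBoolFuns m
    a′ = λ e → a (fsuc e)
    b′ = λ e → b (fsuc e)
    F = λ (o : Fin (suc m) → Bool) → sign o * w (x ℕ.+ weight a b o)
    choose-a : ∀ o → F (true ∷ᶠ o) ≡ sign o * w (x ℕ.+ a fzero ℕ.+ weight a′ b′ o)
    choose-a o = cong₂ (λ s t → s * w t) (ℤP.*-identityˡ (sign o)) (sym (ℕP.+-assoc x (a fzero) _))
    choose-b : ∀ o → F (false ∷ᶠ o) ≡ - (sign o * w (x ℕ.+ b fzero ℕ.+ weight a′ b′ o))
    choose-b o = trans (cong (_* w (x ℕ.+ (b fzero ℕ.+ weight a′ b′ o))) (ℤP.-1*i≡-i (sign o)))
                   (trans (sym (ℤP.neg-distribˡ-* (sign o) _))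
                          (cong (λ t → - (sign o * w t)) (sym (ℕP.+-assoc x (b fzero) _))))

-- Difference operators on k-periodic integer sequences, modulo l

module Differences (k l : ℕ) .{{k≢0 : NonZero k}} where

  Seq : Set
  Seq = ℕ → ℤ

  Null : Seq → Set
  Null f = ∀ x → l ∣ᶻ f x

  Periodic : Seq → Set
  Periodic f = ∀ x → f (x ℕ.+ k) ≡ f x

  Δ : ℕ → Seq → Seq
  Δ d f x = f x - f (x ℕ.+ d)

  periodic-multiple : ∀ {f} → Periodic f → ∀ n x → f (x ℕ.+ n ℕ.* k) ≡ f x
  periodic-multiple {f} p zero x = cong f (ℕP.+-identityʳ x)
  periodic-multiple {f} p (suc n) x =
    trans (cong f (reassoc x n k)) (trans (p (x ℕ.+ n ℕ.* k)) (periodic-multiple p n x))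
    where
      reassoc : ∀ x n k → x ℕ.+ (k ℕ.+ n ℕ.* k) ≡ x ℕ.+ n ℕ.* k ℕ.+ k
      reassoc = ℕSolver.solve-∀

  periodic-unshift : ∀ {f} → Periodic f → ∀ s → Null (λ x → f (x ℕ.+ s)) → Null f
  periodic-unshift {f} p s null x =
    subst (l ∣ᶻ_) (trans (cong f shifted) (periodic-multiple p s x)) (null (x ℕ.+ s ℕ.* ℕ.pred k))
    where
      reassoc : ∀ x s j → x ℕ.+ s ℕ.* j ℕ.+ s ≡ x ℕ.+ s ℕ.* suc j
      reassoc = ℕSolver.solve-∀
      shifted : x ℕ.+ s ℕ.* ℕ.pred k ℕ.+ s ≡ x ℕ.+ s ℕ.* k
      shifted = trans (reassoc x s (ℕ.pred k)) (cong (λ j → x ℕ.+ s ℕ.* j) (ℕP.suc-pred k))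

  Δ-periodic : ∀ d {f} → Periodic f → Periodic (Δ d f)
  Δ-periodic d {f} p x = cong₂ _-_ (p x) (trans (cong f (shift-swap x k d)) (p (x ℕ.+ d)))

  Δ-cong : ∀ d {f g} → f ≗ g → Δ d f ≗ Δ d g
  Δ-cong d eq x = cong₂ _-_ (eq x) (eq (x ℕ.+ d))

  Δ-comm : ∀ a b f → Δ a (Δ b f) ≗ Δ b (Δ a f)
  Δ-comm a b f x =
    trans (diff-exchange (f x) (f (x ℕ.+ b)) (f (x ℕ.+ a)) (f (x ℕ.+ a ℕ.+ b)))
          (cong (λ t → (f x - f (x ℕ.+ a)) - (f (x ℕ.+ b) - f t)) (shift-swap x a b))

  Δ-multiple : ∀ d h → Null (Δ d h) → ∀ n → Null (Δ (n ℕ.* d) h)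
  Δ-multiple d h null zero x =
    subst (l ∣ᶻ_) (sym (trans (cong (λ t → h x - h t) (ℕP.+-identityʳ x)) (ℤP.+-inverseʳ (h x)))) ∣ᶻ-0
  Δ-multiple d h null (suc n) x =
    subst (l ∣ᶻ_) (trans (diff-chain (h x) (h (x ℕ.+ d)) (h (x ℕ.+ d ℕ.+ n ℕ.* d)))
                         (cong (λ t → h x - h t) (ℕP.+-assoc x d (n ℕ.* d))))
          (ℤD.∣m∣n⇒∣m+n (null x) (Δ-multiple d h null n (x ℕ.+ d)))

  ∇ : List ℕ → Seq → Seq
  ∇ [] f = f
  ∇ (d ∷ ds) f = Δ d (∇ ds f)

  ∇-periodic : ∀ ds {f} → Periodic f → Periodic (∇ ds f)
  ∇-periodic [] p = p
  ∇-periodic (d ∷ ds) p = Δ-periodic d (∇-periodic ds p)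

  ∇-Null : ∀ ds {f} → Null f → Null (∇ ds f)
  ∇-Null [] null = null
  ∇-Null (d ∷ ds) null x = ℤD.∣m∣n⇒∣m-n (∇-Null ds null x) (∇-Null ds null (x ℕ.+ d))

  ∇-translates : ∀ ds f a b →
    ∇ ds (λ x → f (x ℕ.+ a) - f (x ℕ.+ b)) ≗ (λ x → ∇ ds f (x ℕ.+ a) - ∇ ds f (x ℕ.+ b))
  ∇-translates [] f a b x = refl
  ∇-translates (d ∷ ds) f a b x =
    trans (cong₂ _-_ (∇-translates ds f a b x) (∇-translates ds f a b (x ℕ.+ d)))
          (trans (diff-exchange (F (x ℕ.+ a)) (F (x ℕ.+ b)) (F (x ℕ.+ d ℕ.+ a)) (F (x ℕ.+ d ℕ.+ b)))
                 (cong₂ (λ s t → (F (x ℕ.+ a) - F s) - (F (x ℕ.+ b) - F t))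
                        (shift-swap x d a) (shift-swap x d b)))
    where
      F = ∇ ds f

  ∇-factor : ∀ {d} ds {g} → d ∈ ds → Periodic g →
             Σ Seq λ y → Periodic y × (∇ ds g ≗ Δ d y)
  ∇-factor (d ∷ ds) {g} (here refl) p = ∇ ds g , ∇-periodic ds p , λ x → refl
  ∇-factor {d} (d′ ∷ ds) (there d∈ds) p with ∇-factor ds d∈ds p
  ... | y , py , eq = Δ d′ y , Δ-periodic d′ py , λ x → trans (Δ-cong d′ eq x) (Δ-comm d′ d y x)

  ∑< : ℕ → (ℕ → ℤ) → ℤ
  ∑< zero F = + 0
  ∑< (suc n) F = ∑< n F + F n

  telescope : ∀ y d x n → ∑< n (λ i → Δ d y (x ℕ.+ i ℕ.* d)) ≡ y x - y (x ℕ.+ n ℕ.* d)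
  telescope y d x zero =
    sym (trans (cong (λ t → y x - y t) (ℕP.+-identityʳ x)) (ℤP.+-inverseʳ (y x)))
  telescope y d x (suc n) =
    trans (cong (_+ Δ d y (x ℕ.+ n ℕ.* d)) (telescope y d x n))
          (trans (diff-chain (y x) (y (x ℕ.+ n ℕ.* d)) (y (x ℕ.+ n ℕ.* d ℕ.+ d)))
                 (cong (λ t → y x - y t) (reassoc x n d)))
    where
      reassoc : ∀ x n d → x ℕ.+ n ℕ.* d ℕ.+ d ≡ x ℕ.+ (d ℕ.+ n ℕ.* d)
      reassoc = ℕSolver.solve-∀

  progression-sum : ∀ d h → Null (Δ d h) →
                    ∀ x n → l ∣ᶻ ∑< n (λ i → h (x ℕ.+ i ℕ.* d)) - + n * h x
  progression-sum d h null x zero = subst (l ∣ᶻ_) (sym (ℤP.*-zeroˡ (h x))) ∣ᶻ-0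
  progression-sum d h null x (suc n) =
    subst (l ∣ᶻ_) (sym (regroup (∑< n (λ i → h (x ℕ.+ i ℕ.* d))) (h (x ℕ.+ n ℕ.* d)) (h x) (+ n)))
          (ℤD.∣m∣n⇒∣m-n (progression-sum d h null x n) (Δ-multiple d h null n x))
    where
      regroup : ∀ (S t u m : ℤ) → (S + t) - (+ 1 + m) * u ≡ (S - m * u) - (u - t)
      regroup = solve-∀

  -- Indeed h = Δ_d y sums to
  -- zero over a period, while modulo l this sum is q · h x.
  coprime-step : ∀ y d q → Periodic y → d ℕ.* q ≡ k → Coprime l q →
                 Null (Δ d (Δ d y)) → Null (Δ d y)
  coprime-step y d q py dq≡k cop null x =
    ℤD.∣ᵤ⇒∣ (coprime-divisor cop (subst (l ℕD.∣_) (ℤP.abs-* (+ q) (h x)) (ℤD.∣⇒∣ᵤ l∣qh)))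
    where
      h = Δ d y
      period-sum : ∑< q (λ i → h (x ℕ.+ i ℕ.* d)) ≡ + 0
      period-sum = begin
        ∑< q (λ i → h (x ℕ.+ i ℕ.* d))  ≡⟨ telescope y d x q ⟩
        y x - y (x ℕ.+ q ℕ.* d)         ≡⟨ cong (λ t → y x - y (x ℕ.+ t)) (trans (ℕP.*-comm q d) dq≡k) ⟩
        y x - y (x ℕ.+ k)               ≡⟨ cong (λ t → y x - t) (py x) ⟩
        y x - y x                       ≡⟨ ℤP.+-inverseʳ (y x) ⟩
        + 0                             ∎
        where open ≡-Reasoning
      l∣qh : l ∣ᶻ + q * h x
      l∣qh = subst (l ∣ᶻ_) (flip-sign (+ q * h x))
               (ℤD.∣m⇒∣-m (subst (λ S → l ∣ᶻ S - + q * h x) period-sum (progression-sum d h null x q)))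
        where
          flip-sign : ∀ (z : ℤ) → - (+ 0 - z) ≡ z
          flip-sign = solve-∀

  -- Bézout: the set of steps d with l ∣ Δ_d h is closed under combination
  -- with the period, so l ∣ Δ_j h implies l ∣ Δ_{gcd(j,k)} h.
  gcd-step : ∀ j h → Periodic h → Null (Δ j h) → Null (Δ (gcd j k) h)
  gcd-step j h ph null with Bézout.identity (gcd-GCD j k)
  ... | Bézout.+- x y eq = λ z → subst (l ∣ᶻ_) (cong (λ t → h z - t) (same z)) (Δ-multiple j h null x z)
    where
      same : ∀ z → h (z ℕ.+ x ℕ.* j) ≡ h (z ℕ.+ gcd j k)
      same z = trans (cong h (sym (trans (ℕP.+-assoc z (gcd j k) (y ℕ.* k)) (cong (z ℕ.+_) eq))))
                     (periodic-multiple ph y (z ℕ.+ gcd j k))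
  ... | Bézout.-+ x y eq = λ z →
          subst (l ∣ᶻ_) (trans (diff-negate (h (z ℕ.+ gcd j k)) _) (cong (_- h (z ℕ.+ gcd j k)) (same z)))
                (ℤD.∣m⇒∣-m (Δ-multiple j h null x (z ℕ.+ gcd j k)))
    where
      same : ∀ z → h (z ℕ.+ gcd j k ℕ.+ x ℕ.* j) ≡ h z
      same z = trans (cong h (trans (ℕP.+-assoc z (gcd j k) (x ℕ.* j)) (cong (z ℕ.+_) eq)))
                     (periodic-multiple ph y z)

  PrimeDivisor : ℕ → Set
  PrimeDivisor q = Prime q × q ℕD.∣ k

  cofactor : ℕ → ℕ
  cofactor zero = 0
  cofactor (suc q) = k / suc q

  cofactor-spec : ∀ {q} → PrimeDivisor q → cofactor q ℕ.* q ≡ k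
  cofactor-spec {zero} (pq , _) = contradiction pq ¬prime[0]
  cofactor-spec {suc q} (_ , q∣k) = m/n*n≡m q∣k

  -- If k ∤ j then gcd(j, k) is a proper divisor of k, so it divides k / q for
  -- some prime q ∣ k (a prime factor of k / gcd(j, k)).
  gcd-divides-cofactor : ∀ j → ¬ k ℕD.∣ j → Σ ℕ λ q → PrimeDivisor q × gcd j k ℕD.∣ cofactor q
  gcd-divides-cofactor j k∤j with gcd[m,n]∣n j k
  ... | divides zero k≡0 = contradiction k≡0 (ℕ.≢-nonZero⁻¹ k)
  ... | divides (suc zero) k≡g =
        contradiction (subst (ℕD._∣ j) (sym (trans k≡g (ℕP.+-identityʳ _))) (gcd[m,n]∣m j k)) k∤j
  ... | divides (suc (suc t)) k≡tg with factorise (suc (suc t))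
  ... | record { factors = [] ; isFactorisation = () }
  ... | record { factors = q ∷ rest ; isFactorisation = t≡q*r ; factorsPrime = pq ∷ _ } =
        q , (pq , q∣k) , divides (product rest) cofactor≡
    where
      g = gcd j k
      k≡ : k ≡ product rest ℕ.* g ℕ.* q
      k≡ = trans k≡tg (trans (cong (ℕ._* g) t≡q*r) (regroup q (product rest) g))
        where
          regroup : ∀ q r g → q ℕ.* r ℕ.* g ≡ r ℕ.* g ℕ.* q
          regroup = ℕSolver.solve-∀
      q∣k : q ℕD.∣ k
      q∣k = divides (product rest ℕ.* g) k≡
      cofactor≡ : cofactor q ≡ product rest ℕ.* g
      cofactor≡ = ℕP.*-cancelʳ-≡ (cofactor q) _ q {{prime⇒nonZero pq}}
                    (trans (cofactor-spec (pq , q∣k)) k≡)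

  primeDivisors : List ℕ
  primeDivisors = filter (λ q → prime? q ×-dec q ∣? k) (upTo (suc k))

  ∈-primeDivisors : ∀ {q} → PrimeDivisor q → q ∈ primeDivisors
  ∈-primeDivisors (pq , q∣k) =
    ∈-filter⁺ (λ q → prime? q ×-dec q ∣? k) (∈-upTo⁺ (s≤s (ℕD.∣⇒≤ q∣k))) (pq , q∣k)

  δ : Seq
  δ x = 𝟙 (k ∣? x)

  δ-periodic : Periodic δ
  δ-periodic x with k ∣? (x ℕ.+ k) | k ∣? x
  ... | yes _ | yes _ = refl
  ... | no _  | no _  = refl
  ... | yes k∣x+k | no k∤x =
        contradiction (ℕD.∣m+n∣m⇒∣n (subst (k ℕD.∣_) (ℕP.+-comm x k) k∣x+k) ℕD.∣-refl) k∤x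
  ... | no k∤x+k | yes k∣x = contradiction (ℕD.∣m∣n⇒∣m+n k∣x ℕD.∣-refl) k∤x+k

  support : ∀ qs → All PrimeDivisor qs → ∀ x → ∇ (map cofactor qs) δ x ≢ + 0 →
            k ℕD.∣ product qs ℕ.* x
  support [] [] x δx≢0 with k ∣? x
  ... | yes k∣x = subst (k ℕD.∣_) (sym (ℕP.*-identityˡ x)) k∣x
  ... | no _ = contradiction refl δx≢0
  support (q ∷ qs) (dq ∷ dqs) x ∇x≢0 with F x ℤ.≟ + 0 | F (x ℕ.+ cofactor q) ℤ.≟ + 0
    where F = ∇ (map cofactor qs) δ
  ... | no Fx≢0 | _ =
        subst (k ℕD.∣_) (sym (ℕP.*-assoc q (product qs) x)) (ℕD.∣n⇒∣m*n q (support qs dqs x Fx≢0))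
  ... | yes Fx≡0 | yes Fx′≡0 = contradiction (cong₂ _-_ Fx≡0 Fx′≡0) ∇x≢0
  ... | yes _ | no Fx′≢0 =
        ℕD.∣m+n∣m⇒∣n (subst (k ℕD.∣_) (expand q (product qs) x (cofactor q)) k∣shifted) k∣P·k
    where
      k∣shifted : k ℕD.∣ q ℕ.* (product qs ℕ.* (x ℕ.+ cofactor q))
      k∣shifted = ℕD.∣n⇒∣m*n q (support qs dqs (x ℕ.+ cofactor q) Fx′≢0)
      expand : ∀ q P x c → q ℕ.* (P ℕ.* (x ℕ.+ c)) ≡ P ℕ.* (c ℕ.* q) ℕ.+ q ℕ.* P ℕ.* x
      expand = ℕSolver.solve-∀
      k∣P·k : k ℕD.∣ product qs ℕ.* (cofactor q ℕ.* q)
      k∣P·k = ℕD.∣n⇒∣m*n (product qs) (ℕD.∣-reflexive (sym (cofactor-spec dq)))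

  -- For distinct primes q₁…qᵣ dividing k, (Δ_{k/q₁} ⋯ Δ_{k/qᵣ} δ)(0) = 1: the new
  -- term (Δ_{k/q₂} ⋯ δ)(k/q₁) vanishes, or support would give q₁ ∣ q₂ ⋯ qᵣ.
  value-at-0 : ∀ qs → Unique qs → All PrimeDivisor qs → ∇ (map cofactor qs) δ 0 ≡ + 1
  value-at-0 [] [] [] with k ∣? 0
  ... | yes _ = refl
  ... | no k∤0 = contradiction (k ℕD.∣0) k∤0
  value-at-0 (q ∷ qs) (q∉qs ∷ uniq) (dq ∷ dqs) with F (cofactor q) ℤ.≟ + 0
    where F = ∇ (map cofactor qs) δ
  ... | yes F≡0 = cong₂ _-_ (value-at-0 qs uniq dqs) F≡0
  ... | no F≢0 = contradiction q∈qs (All¬⇒¬Any q∉qs)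
    where
      c = cofactor q
      c≢0 : c ≢ 0
      c≢0 c≡0 = ℕ.≢-nonZero⁻¹ k (trans (sym (cofactor-spec dq)) (cong (ℕ._* q) c≡0))
      q∣P : q ℕD.∣ product qs
      q∣P = ℕD.*-cancelʳ-∣ c {{ℕ.≢-nonZero c≢0}}
              (subst (ℕD._∣ product qs ℕ.* c) (trans (sym (cofactor-spec dq)) (ℕP.*-comm c q))
                     (support qs dqs c F≢0))
      q∈qs : q ∈ qs
      q∈qs = factorisationHasAllPrimeFactors (proj₁ dq) q∣P (All.map proj₁ dqs)

  steps : List ℕ
  steps = map cofactor primeDivisors

  K : Seq → Seq
  K = ∇ steps

  K-δ-at-0 : K δ 0 ≡ + 1
  K-δ-at-0 = value-at-0 primeDivisors (Unique.filter⁺ P? (Unique.upTo⁺ (suc k))) (all-filter P? (upTo (suc k)))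
    where
      P? = λ q → prime? q ×-dec q ∣? k

  -- By gcd-step, l ∣ Δ_{k/q} (K g) for some
  -- prime q ∣ k; writing K g = Δ_{k/q} y, coprime-step concludes.
  key : Coprime l k → ∀ {g} j → Periodic g → ¬ k ℕD.∣ j → Null (Δ j (K g)) → Null (K g)
  key cop {g} j pg k∤j null with gcd-divides-cofactor j k∤j
  ... | q , dq , divides r c≡rg with ∇-factor steps (∈-map⁺ cofactor (∈-primeDivisors dq)) pg
  ... | y , py , Kg≗Δy = λ x →
        subst (l ∣ᶻ_) (sym (Kg≗Δy x)) (coprime-step y (cofactor q) q py (cofactor-spec dq) cop-q null-c x)
    where
      null-c : Null (Δ (cofactor q) (Δ (cofactor q) y))
      null-c x = subst (l ∣ᶻ_) (trans (cong (λ c → Δ c (K g) x) (sym c≡rg)) (Δ-cong (cofactor q) Kg≗Δy x))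
                   (Δ-multiple (gcd j k) (K g) (gcd-step j (K g) (∇-periodic steps pg) null) r x)
      cop-q : Coprime l q
      cop-q (d∣l , d∣q) = cop (d∣l , ℕD.∣-trans d∣q (proj₂ dq))

  nonMultiple : ∀ {j} → 0 < j → j < k → ¬ k ℕD.∣ j
  nonMultiple 0<j j<k k∣j = ℕP.<⇒≱ j<k (ℕD.∣⇒≤ {{ℕ.>-nonZero 0<j}} k∣j)

  ordered-translates : Coprime l k → ∀ {g} a b → Periodic g → a < b → b < k →
                       Null (λ x → K g (x ℕ.+ a) - K g (x ℕ.+ b)) → Null (K g)
  ordered-translates cop {g} a b pg a<b b<k null =
    key cop (b ∸ a) pg (nonMultiple (ℕP.m<n⇒0<n∸m a<b) (ℕP.≤-<-trans (ℕP.m∸n≤m b a) b<k))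
        (periodic-unshift (Δ-periodic (b ∸ a) (∇-periodic steps pg)) a
          (λ x → subst (λ t → l ∣ᶻ K g (x ℕ.+ a) - K g t) (sym (step x)) (null x)))
    where
      step : ∀ x → x ℕ.+ a ℕ.+ (b ∸ a) ≡ x ℕ.+ b
      step x = trans (ℕP.+-assoc x a (b ∸ a)) (cong (x ℕ.+_) (ℕP.m+[n∸m]≡n (ℕP.<⇒≤ a<b)))

  distinct-translates : Coprime l k → ∀ {g} a b → Periodic g → a < k → b < k → a ≢ b →
                        Null (λ x → K g (x ℕ.+ a) - K g (x ℕ.+ b)) → Null (K g)
  distinct-translates cop {g} a b pg a<k b<k a≢b null with ℕP.<-cmp a b
  ... | tri< a<b _ _ = ordered-translates cop a b pg a<b b<k null
  ... | tri≈ _ a≡b _ = contradiction a≡b a≢b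
  ... | tri> _ _ b<a = ordered-translates cop b a pg b<a a<k
          (λ x → subst (l ∣ᶻ_) (diff-negate (K g (x ℕ.+ a)) (K g (x ℕ.+ b))) (ℤD.∣m⇒∣-m (null x)))

  H-periodic : ∀ m a b {w} → Periodic w → Periodic (H m a b w)
  H-periodic zero a b p = p
  H-periodic (suc m) a b {w} p x =
    cong₂ _-_ (trans (cong G (shift-swap x k (a fzero))) (IH (x ℕ.+ a fzero)))
              (trans (cong G (shift-swap x k (b fzero))) (IH (x ℕ.+ b fzero)))
    where
      G = H m (λ e → a (fsuc e)) (λ e → b (fsuc e)) w
      IH = H-periodic m (λ e → a (fsuc e)) (λ e → b (fsuc e)) p

  K-H-nonvanishing : 2 ≤ l → Coprime l k → ∀ m (a b : Fin m → ℕ) →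
                     (∀ e → a e < k) → (∀ e → b e < k) → (∀ e → a e ≢ b e) → ¬ Null (K (H m a b δ))
  K-H-nonvanishing 2≤l cop zero a b _ _ _ null =
    ℕP.<⇒≢ 2≤l (sym (ℕD.∣1⇒≡1 (ℤD.∣⇒∣ᵤ (subst (l ∣ᶻ_) K-δ-at-0 (null 0)))))
  K-H-nonvanishing 2≤l cop (suc m) a b a<k b<k a≢b null =
    K-H-nonvanishing 2≤l cop m a′ b′ (λ e → a<k (fsuc e)) (λ e → b<k (fsuc e)) (λ e → a≢b (fsuc e))
      (distinct-translates cop (a fzero) (b fzero) (H-periodic m a′ b′ δ-periodic)
         (a<k fzero) (b<k fzero) (a≢b fzero)
         (λ x → subst (l ∣ᶻ_) (∇-translates steps (H m a′ b′ δ) (a fzero) (b fzero) x) (null x)))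
    where
      a′ = λ e → a (fsuc e)
      b′ = λ e → b (fsuc e)

𝟙ⁿ : ∀ {A : Set} → Dec A → ℕ
𝟙ⁿ A? = if does A? then 1 else 0

length-filter-tabulate : ∀ {A : Set} {P : A → Set} (P? : ∀ a → Dec (P a)) n (f : Fin n → A) →
                         length (filter P? (tabulate f)) ≡ sum (λ i → 𝟙ⁿ (P? (f i)))
length-filter-tabulate P? zero f = refl
length-filter-tabulate P? (suc n) f with does (P? (f fzero))
... | true  = cong suc (length-filter-tabulate P? n (λ i → f (fsuc i)))
... | false = length-filter-tabulate P? n (λ i → f (fsuc i))

differences : ∀ {m} → (Fin m → Bool) → (Fin m → Bool) → ℕ
differences o o′ = sum (λ e → 𝟙ⁿ (bdiff (o e) (o′ e) Bool.≟ true))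

sign-product : ∀ {m} (o o′ : Fin m → Bool) → sign o * sign o′ ≡ -1ℤ ^ differences o o′
sign-product {zero} o o′ = refl
sign-product {suc m} o o′ = begin
  (sgn p * S) * (sgn p′ * S′)      ≡⟨ interchange (sgn p) S (sgn p′) S′ ⟩
  (sgn p * sgn p′) * (S * S′)      ≡⟨ cong₂ _*_ (sgn-pair p p′) (sign-product o⁻ o′⁻) ⟩
  -1ℤ ^ d * -1ℤ ^ D                ≡⟨ ℤP.^-distribˡ-+-* -1ℤ d D ⟨
  -1ℤ ^ (d ℕ.+ D)                  ∎
  where
    open ≡-Reasoning
    p = o fzero
    p′ = o′ fzero
    o⁻ = λ e → o (fsuc e)
    o′⁻ = λ e → o′ (fsuc e)
    S = sign o⁻
    S′ = sign o′⁻
    d = 𝟙ⁿ (bdiff p p′ Bool.≟ true)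
    D = differences o⁻ o′⁻
    interchange : ∀ (p q r s : ℤ) → (p * q) * (r * s) ≡ (p * r) * (q * s)
    interchange = solve-∀
    sgn-pair : ∀ p p′ → sgn p * sgn p′ ≡ -1ℤ ^ 𝟙ⁿ (bdiff p p′ Bool.≟ true)
    sgn-pair true true = refl
    sgn-pair true false = refl
    sgn-pair false true = refl
    sgn-pair false false = refl

sign-square : ∀ {m} (o : Fin m → Bool) → sign o * sign o ≡ + 1
sign-square {zero} o = refl
sign-square {suc m} o =
  trans (interchange (sgn (o fzero)) (sign (λ e → o (fsuc e))))
        (cong₂ _*_ (sgn-square (o fzero)) (sign-square (λ e → o (fsuc e))))
  where
    interchange : ∀ (p q : ℤ) → (p * q) * (p * q) ≡ (p * p) * (q * q)
    interchange = solve-∀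
    sgn-square : ∀ p → sgn p * sgn p ≡ + 1
    sgn-square true = refl
    sgn-square false = refl

sign-cancel : ∀ {m} (o : Fin m → Bool) z → sign o * (sign o * z) ≡ z
sign-cancel o z = trans (sym (ℤP.*-assoc (sign o) (sign o) z)) (trans (cong (_* z) (sign-square o)) (ℤP.*-identityˡ z))

twice-negated : ∀ z → -1ℤ * (-1ℤ * z) ≡ z
twice-negated z = trans (ℤP.-1*i≡-i _) (trans (cong -_ (ℤP.-1*i≡-i z)) (ℤP.neg-involutive z))

parity : ∀ n → (2 ℕD.∣ n × -1ℤ ^ n ≡ + 1) ⊎ (¬ 2 ℕD.∣ n × -1ℤ ^ n ≡ -1ℤ)
parity zero = inj₁ (2 ℕD.∣0 , refl)
parity (suc zero) = inj₂ ((λ 2∣1 → contradiction (ℕD.∣1⇒≡1 2∣1) (λ ())) , refl)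
parity (suc (suc n)) with parity n
... | inj₁ (2∣n , even) = inj₁ (ℕD.∣m∣n⇒∣m+n (ℕD.∣-refl {2}) 2∣n , trans (twice-negated (-1ℤ ^ n)) even)
... | inj₂ (2∤n , odd)  =
      inj₂ ((λ 2∣n+2 → 2∤n (ℕD.∣m+n∣m⇒∣n 2∣n+2 ℕD.∣-refl)) , trans (twice-negated (-1ℤ ^ n)) odd)

∣+a-+b∣ : ∀ a b → ℤ.∣ + a - + b ∣ ≡ ℕ.∣ a - b ∣
∣+a-+b∣ a b with ℕP.≤-total a b
... | inj₁ a≤b = trans (cong ℤ.∣_∣ (ℤP.[+m]-[+n]≡m⊖n a b))
                       (trans (ℤP.∣⊖∣-≤ a≤b) (sym (ℕP.m≤n⇒∣m-n∣≡n∸m a≤b)))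
... | inj₂ b≤a = trans (cong ℤ.∣_∣ (ℤP.[+m]-[+n]≡m⊖n a b))
                       (trans (ℤP.∣m⊖n∣≡∣n⊖m∣ a b)
                              (trans (ℤP.∣⊖∣-≤ b≤a) (sym (ℕP.m≤n⇒∣n-m∣≡n∸m b≤a))))

mod⇒∣ᶻ : ∀ {q} a b → a ≡ b [mod q ] → q ∣ᶻ + a - + b
mod⇒∣ᶻ {q} a b q∣ = ℤD.∣ᵤ⇒∣ (subst (q ℕD.∣_) (sym (∣+a-+b∣ a b)) q∣)

∣ᶻ⇒mod : ∀ {q} a b → q ∣ᶻ + a - + b → a ≡ b [mod q ]
∣ᶻ⇒mod {q} a b q∣ = subst (q ℕD.∣_) (∣+a-+b∣ a b) (ℤD.∣⇒∣ᵤ q∣)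

∣ᶻ-transfer : ∀ {q} a b → q ∣ᶻ + a - + b → q ℕD.∣ a → q ℕD.∣ b
∣ᶻ-transfer {q} a b q∣a-b q∣a =
  ℤD.∣⇒∣ᵤ (subst (q ∣ᶻ_) (cancel (+ a) (+ b)) (ℤD.∣m∣n⇒∣m-n (ℤD.∣ᵤ⇒∣ {i = + a} q∣a) q∣a-b))
  where
    cancel : ∀ (p r : ℤ) → p - (p - r) ≡ r
    cancel = solve-∀

weighted-sum-congruence : ∀ q {n} (C p p′ : Fin n → ℕ) → (∀ v → q ∣ᶻ + p v - + p′ v) →
                          q ∣ᶻ + sum (λ v → C v ℕ.* p v) - + sum (λ v → C v ℕ.* p′ v)
weighted-sum-congruence q {zero} C p p′ q∣ = ∣ᶻ-0
weighted-sum-congruence q {suc n} C p p′ q∣ =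
  subst (q ∣ᶻ_) (sym split)
        (ℤD.∣m∣n⇒∣m+n (ℤD.∣n⇒∣m*n (+ C fzero) (q∣ fzero))
                      (weighted-sum-congruence q (λ v → C (fsuc v)) (λ v → p (fsuc v))
                                                 (λ v → p′ (fsuc v)) (λ v → q∣ (fsuc v))))
  where
    S  = sum (λ v → C (fsuc v) ℕ.* p (fsuc v))
    S′ = sum (λ v → C (fsuc v) ℕ.* p′ (fsuc v))
    regroup : ∀ (c r r′ s s′ : ℤ) → (c * r + s) - (c * r′ + s′) ≡ c * (r - r′) + (s - s′)
    regroup = solve-∀
    lift : ∀ r s → + (C fzero ℕ.* r ℕ.+ s) ≡ + C fzero * + r + + s
    lift r s = trans (ℤP.pos-+ (C fzero ℕ.* r) s) (cong (_+ + s) (ℤP.pos-* (C fzero) r))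
    split : + (C fzero ℕ.* p fzero ℕ.+ S) - + (C fzero ℕ.* p′ fzero ℕ.+ S′)
            ≡ + C fzero * (+ p fzero - + p′ fzero) + (+ S - + S′)
    split = trans (cong₂ _-_ (lift (p fzero) S) (lift (p′ fzero) S′))
                  (regroup (+ C fzero) (+ p fzero) (+ p′ fzero) (+ S) (+ S′))

select : ∀ {n} (C : Fin n → ℕ) y → sum (λ v → C v ℕ.* 𝟙ⁿ (y Fin.≟ v)) ≡ C y
select {suc n} C fzero =
  trans (cong₂ ℕ._+_ (ℕP.*-identityʳ (C fzero))
                     (trans (sum-cong-≗ (λ v → ℕP.*-zeroʳ (C (fsuc v)))) (sum-replicate-zero n)))
        (ℕP.+-identityʳ (C fzero))
select {suc n} C (fsuc y) =
  trans (cong (ℕ._+ sum (λ v → C (fsuc v) ℕ.* 𝟙ⁿ (y Fin.≟ v))) (ℕP.*-zeroʳ (C fzero)))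
        (select (λ v → C (fsuc v)) y)

double-count : ∀ {m n} (t : Fin m → Fin n) (C : Fin n → ℕ) →
               sum (λ e → C (t e)) ≡ sum (λ v → C v ℕ.* sum (λ e → 𝟙ⁿ (t e Fin.≟ v)))
double-count t C = begin
  sum (λ e → C (t e))                                ≡⟨ sum-cong-≗ (λ e → sym (select C (t e))) ⟩
  sum (λ e → sum (λ v → C v ℕ.* 𝟙ⁿ (t e Fin.≟ v)))   ≡⟨ ∑-comm (λ e v → C v ℕ.* 𝟙ⁿ (t e Fin.≟ v)) ⟩
  sum (λ v → sum (λ e → C v ℕ.* 𝟙ⁿ (t e Fin.≟ v)))
    ≡⟨ sum-cong-≗ (λ v → sym (*-distribˡ-sum (C v) (λ e → 𝟙ⁿ (t e Fin.≟ v)))) ⟩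
  sum (λ v → C v ℕ.* sum (λ e → 𝟙ⁿ (t e Fin.≟ v)))   ∎
  where open ≡-Reasoning

module ClosedSums {A : Set} (R : A → A → Set) (R? : ∀ a b → Dec (R a b))
                  (R-refl : ∀ {a} → R a a) (R-sym : ∀ {a b} → R a b → R b a)
                  (R-trans : ∀ {a b c} → R a b → R b c → R a c)
                  (l : ℕ) (xs : List A) (s : A → ℤ)
                  (balanced : ∀ {h} → h ∈ xs → l ∣ᶻ ∑ᴸ xs (λ a → 𝟙 (R? a h) * s a)) where

  Closed : (A → Set) → Set
  Closed Q = ∀ {a b} → R a b → Q b → Q a

  -- Induction on a list ys ⊆ xs containing every element of Q: split off
  -- the class of the first element of ys that lies in Q.
  closed-sum-within : ∀ ys {Q : A → Set} (Q? : ∀ a → Dec (Q a)) → Closed Q →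
                      (∀ {a} → a ∈ ys → a ∈ xs) → (∀ {a} → a ∈ xs → Q a → a ∈ ys) →
                      l ∣ᶻ ∑ᴸ xs (λ a → 𝟙 (Q? a) * s a)
  closed-sum-within [] Q? closed ys⊆xs covers = subst (l ∣ᶻ_) (sym (∑ᴸ-vanish xs _ empty)) ∣ᶻ-0
    where
      empty : ∀ {a} → a ∈ xs → 𝟙 (Q? a) * s a ≡ + 0
      empty {a} a∈xs with Q? a
      ... | yes qa = contradiction (covers a∈xs qa) (λ ())
      ... | no _ = ℤP.*-zeroˡ (s a)
  closed-sum-within (h ∷ ys) {Q} Q? closed ys⊆xs covers with Q? h
  ... | no ¬qh = closed-sum-within ys Q? closed (λ a∈ys → ys⊆xs (there a∈ys)) covers′
    where
      covers′ : ∀ {a} → a ∈ xs → Q a → a ∈ ys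
      covers′ a∈xs qa with covers a∈xs qa
      ... | here refl = contradiction qa ¬qh
      ... | there a∈ys = a∈ys
  ... | yes qh =
        subst (l ∣ᶻ_) (sym split)
              (ℤD.∣m∣n⇒∣m+n (balanced (ys⊆xs (here refl)))
                            (closed-sum-within ys Q′? closed′ (λ a∈ys → ys⊆xs (there a∈ys)) covers′))
    where
      Q′ : A → Set
      Q′ a = Q a × ¬ R a h
      Q′? : ∀ a → Dec (Q′ a)
      Q′? a = Q? a ×-dec ¬? (R? a h)
      closed′ : Closed Q′
      closed′ rab (qb , ¬rbh) = closed rab qb , λ rah → ¬rbh (R-trans (R-sym rab) rah)
      covers′ : ∀ {a} → a ∈ xs → Q′ a → a ∈ ys
      covers′ a∈xs (qa , ¬rah) with covers a∈xs qa
      ... | here refl = contradiction R-refl ¬rah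
      ... | there a∈ys = a∈ys
      pointwise : ∀ a → 𝟙 (Q? a) * s a ≡ 𝟙 (R? a h) * s a + 𝟙 (Q′? a) * s a
      pointwise a with R? a h | Q? a
      ... | yes rah | yes _  = sym (ℤP.+-identityʳ _)
      ... | yes rah | no ¬qa = contradiction (closed rah qh) ¬qa
      ... | no _    | yes _  = sym (ℤP.+-identityˡ _)
      ... | no _    | no _   = sym (ℤP.+-identityˡ _)
      split : ∑ᴸ xs (λ a → 𝟙 (Q? a) * s a)
              ≡ ∑ᴸ xs (λ a → 𝟙 (R? a h) * s a) + ∑ᴸ xs (λ a → 𝟙 (Q′? a) * s a)
      split = trans (∑ᴸ-cong xs pointwise) (∑ᴸ-+ xs _ _)

  closed-sum : ∀ {Q : A → Set} (Q? : ∀ a → Dec (Q a)) → Closed Q → l ∣ᶻ ∑ᴸ xs (λ a → 𝟙 (Q? a) * s a)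
  closed-sum Q? closed = closed-sum-within xs Q? closed (λ a∈xs → a∈xs) (λ a∈xs _ → a∈xs)

-- Orientations of a graph, their congruence classes and subclasses

module Orientations (L : Graph) (k : ℕ) where

  congruent-refl : ∀ {o} → Congruent L k o o
  congruent-refl {o} v = subst (k ℕD.∣_) (sym (ℕP.∣n-n∣≡0 (outdeg L o v))) (k ℕD.∣0)

  congruent-sym : ∀ {o o′} → Congruent L k o o′ → Congruent L k o′ o
  congruent-sym {o} {o′} o≈o′ v = subst (k ℕD.∣_) (ℕP.∣-∣-comm (outdeg L o v) (outdeg L o′ v)) (o≈o′ v)

  congruent-trans : ∀ {o o′ o″} → Congruent L k o o′ → Congruent L k o′ o″ → Congruent L k o o″
  congruent-trans {o} {o′} {o″} o≈o′ o′≈o″ v =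
    ∣ᶻ⇒mod (d o) (d o″) (subst (k ∣ᶻ_) (diff-chain (+ d o) (+ d o′) (+ d o″))
                               (ℤD.∣m∣n⇒∣m+n (mod⇒∣ᶻ (d o) (d o′) (o≈o′ v))
                                             (mod⇒∣ᶻ (d o′) (d o″) (o′≈o″ v))))
    where
      d = λ o → outdeg L o v

  sign-numDiffer : ∀ o o₀ → sign o * sign o₀ ≡ -1ℤ ^ numDiffer L o o₀
  sign-numDiffer o o₀ =
    trans (sign-product o o₀)
          (cong (-1ℤ ^_) (sym (length-filter-tabulate (λ e → bdiff (o e) (o₀ e) Bool.≟ true) (m L) (λ e → e))))

  sign-agreement : ∀ o o₀ → (Agree L o o₀ → sign o * sign o₀ ≡ + 1)
                          × (¬ Agree L o o₀ → sign o * sign o₀ ≡ -1ℤ)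
  sign-agreement o o₀ with parity (numDiffer L o o₀)
  ... | inj₁ (even , -1^d≡1)  = (λ _ → trans (sign-numDiffer o o₀) -1^d≡1) , (λ odd → contradiction even odd)
  ... | inj₂ (odd , -1^d≡-1) = (λ even → contradiction even odd) , (λ _ → trans (sign-numDiffer o o₀) -1^d≡-1)

  signed-indicator : ∀ {P Q : Set} (P? : Dec P) (Q? : Dec Q) {σ σ₀ : ℤ} →
                     (Q → σ * σ₀ ≡ + 1) × (¬ Q → σ * σ₀ ≡ -1ℤ) →
                     𝟙 (P? ×-dec Q?) - 𝟙 (P? ×-dec ¬? Q?) ≡ σ₀ * (𝟙 P? * σ)
  signed-indicator (no _) Q? {σ} {σ₀} _ = sym (trans (cong (σ₀ *_) (ℤP.*-zeroˡ σ)) (ℤP.*-zeroʳ σ₀))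
  signed-indicator (yes _) (yes q) {σ} {σ₀} (on , _) =
    sym (trans (cong (σ₀ *_) (ℤP.*-identityˡ σ)) (trans (ℤP.*-comm σ₀ σ) (on q)))
  signed-indicator (yes _) (no ¬q) {σ} {σ₀} (_ , off) =
    sym (trans (cong (σ₀ *_) (ℤP.*-identityˡ σ)) (trans (ℤP.*-comm σ₀ σ) (off ¬q)))

  classSum : Orientation L → ℤ
  classSum o₀ = ∑ᴸ (allOrientations L) (λ o → 𝟙 (congruent? L k o o₀) * sign o)

  subclass-difference : ∀ o₀ → + subclassAgree L k o₀ - + subclassDisagree L k o₀ ≡ sign o₀ * classSum o₀
  subclass-difference o₀ = begin
    + subclassAgree L k o₀ - + subclassDisagree L k o₀
      ≡⟨ cong₂ _-_ (length-filter (λ o → C? o ×-dec A? o) xs) (length-filter (λ o → C? o ×-dec ¬? (A? o)) xs) ⟩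
    ∑ᴸ xs (λ o → 𝟙 (C? o ×-dec A? o)) - ∑ᴸ xs (λ o → 𝟙 (C? o ×-dec ¬? (A? o)))
      ≡⟨ ∑ᴸ-− xs _ _ ⟨
    ∑ᴸ xs (λ o → 𝟙 (C? o ×-dec A? o) - 𝟙 (C? o ×-dec ¬? (A? o)))
      ≡⟨ ∑ᴸ-cong xs pointwise ⟩
    ∑ᴸ xs (λ o → sign o₀ * (𝟙 (C? o) * sign o))
      ≡⟨ ∑ᴸ-scale xs (sign o₀) _ ⟩
    sign o₀ * classSum o₀ ∎
    where
      open ≡-Reasoning
      xs = allOrientations L
      C? : ∀ o → Dec (Congruent L k o o₀)
      C? o = congruent? L k o o₀
      A? : ∀ o → Dec (Agree L o o₀)
      A? o = agree? L o o₀
      pointwise : ∀ o → 𝟙 (C? o ×-dec A? o) - 𝟙 (C? o ×-dec ¬? (A? o)) ≡ sign o₀ * (𝟙 (C? o) * sign o)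
      pointwise o = signed-indicator (C? o) (A? o) {sign o} {sign o₀} (sign-agreement o o₀)

  balanced-class : ∀ {l} o₀ → subclassAgree L k o₀ ≡ subclassDisagree L k o₀ [mod l ] → l ∣ᶻ classSum o₀
  balanced-class {l} o₀ cong-l = subst (l ∣ᶻ_) (sign-cancel o₀ (classSum o₀)) (ℤD.∣n⇒∣m*n (sign o₀) l∣difference)
    where
      l∣difference : l ∣ᶻ sign o₀ * classSum o₀
      l∣difference = subst (l ∣ᶻ_) (subclass-difference o₀)
                           (mod⇒∣ᶻ (subclassAgree L k o₀) (subclassDisagree L k o₀) cong-l)

  module Coloured (c : Fin (n L) → Fin k) where

    colour : Fin (n L) → ℕ
    colour v = toℕ (c v)

    first second : Fin (m L) → ℕ
    first e = colour (proj₁ (ends L e))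
    second e = colour (proj₂ (ends L e))

    φ : Orientation L → ℕ
    φ = weight first second

    φ-by-vertices : ∀ o → φ o ≡ sum (λ v → colour v ℕ.* outdeg L o v)
    φ-by-vertices o = begin
      φ o                                                     ≡⟨ sum-cong-≗ tail-colour ⟩
      sum (λ e → colour (tailOf L o e))                        ≡⟨ double-count (tailOf L o) colour ⟩
      sum (λ v → colour v ℕ.* sum (λ e → 𝟙ⁿ (tailOf L o e Fin.≟ v)))
        ≡⟨ sum-cong-≗ (λ v → cong (colour v ℕ.*_) (sym (out-degree v))) ⟩
      sum (λ v → colour v ℕ.* outdeg L o v)                    ∎
      where
        open ≡-Reasoning
        out-degree : ∀ v → outdeg L o v ≡ sum (λ e → 𝟙ⁿ (tailOf L o e Fin.≟ v))
        out-degree v = length-filter-tabulate (λ e → tailOf L o e Fin.≟ v) (m L) (λ e → e)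
        tail-colour : ∀ e → (if o e then first e else second e) ≡ colour (tailOf L o e)
        tail-colour e with o e
        ... | true  = refl
        ... | false = refl

    φ-congruent : ∀ {o o′} → Congruent L k o o′ → k ∣ᶻ + φ o - + φ o′
    φ-congruent {o} {o′} o≈o′ =
      subst (k ∣ᶻ_) (sym (cong₂ (λ p q → + p - + q) (φ-by-vertices o) (φ-by-vertices o′)))
            (weighted-sum-congruence k colour (outdeg L o) (outdeg L o′)
                                     (λ v → mod⇒∣ᶻ (outdeg L o v) (outdeg L o′ v) (o≈o′ v)))

    φ-shift-invariant : ∀ x {o o′} → Congruent L k o o′ → k ℕD.∣ x ℕ.+ φ o′ → k ℕD.∣ x ℕ.+ φ o
    φ-shift-invariant x {o} {o′} o≈o′ =
      ∣ᶻ-transfer (x ℕ.+ φ o′) (x ℕ.+ φ o) (subst (k ∣ᶻ_) (sym shift) (φ-congruent (congruent-sym o≈o′)))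
      where
        cancel : ∀ (z p q : ℤ) → (z + p) - (z + q) ≡ p - q
        cancel = solve-∀
        shift : + (x ℕ.+ φ o′) - + (x ℕ.+ φ o) ≡ + φ o′ - + φ o
        shift = trans (cong₂ _-_ (ℤP.pos-+ x (φ o′)) (ℤP.pos-+ x (φ o))) (cancel (+ x) (+ φ o′) (+ φ o))

mainTheorem2 : (k : ℕ) → 1 ≤ k → (L : Graph) → ProperColoring L k →
    (l : ℕ) → 2 ≤ l → gcd l k ≡ 1 →
    ∃ λ (o₀ : Orientation L) →
      ¬ (subclassAgree L k o₀ ≡ subclassDisagree L k o₀ [mod l ])
mainTheorem2 (suc k₀) _ L (c , proper) l 2≤l gcd≡1
  with any? (λ o → ¬? (congMod? (subclassAgree L (suc k₀) o) (subclassDisagree L (suc k₀) o) l)) (allOrientations L)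
... | yes unbalanced = satisfied unbalanced
... | no none = ⊥-elim (
  K-H-nonvanishing 2≤l (gcd≡1⇒coprime gcd≡1) (m L) first second
    (λ e → toℕ<n _) (λ e → toℕ<n _) (λ e same → proper e (toℕ-injective same))
    (∇-Null steps H-null))
  where
    k = suc k₀
    open Differences k l
    open Orientations L k
    open Coloured c
    xs = allOrientations L
    balanced : ∀ {o₀} → o₀ ∈ xs → l ∣ᶻ classSum o₀
    balanced {o₀} o₀∈xs =
      balanced-class o₀ (decidable-stable (congMod? (subclassAgree L k o₀) (subclassDisagree L k o₀) l)
                                          (All.lookup (¬Any⇒All¬ xs none) o₀∈xs))
    open ClosedSums (Congruent L k) (congruent? L k) congruent-refl congruent-sym congruent-trans l xs sign balanced
    -- hence H vanishes modulo l: its expansion is a signed sum over a union of classes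
    H-null : Null (H (m L) first second δ)
    H-null x =
      subst (l ∣ᶻ_) (sym (trans (H-expansion (m L) first second δ x) (∑ᴸ-cong xs (λ o → ℤP.*-comm (sign o) _))))
            (closed-sum (λ o → k ∣? x ℕ.+ φ o) (φ-shift-invariant x))
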